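{- Let $0\le m\le n$ and let $M=U^m_n$ be the uniform matroid with ground set $E$. Let $\pi=(B_1,\dots,B_j)$ be an ordered set partition of $E$ with $k_i=|B_i|$, let $\ell$ be the least integer such that $k_1+\cdots+k_\ell\ge m$, and let $T(\pi)$ be the term associated to $\pi$. Then: (1) If $k_1+\cdots+k_\ell=m$, then $T(\pi)$ is $U^m_m$ with ground set $B_1\cup\cdots\cup B_\ell$. (2) If $k_1+\cdots+k_\ell>m$, then \[ T(\pi)=U^{k_1+\cdots+k_{\ell-1}}_{k_1+\cdots+k_{\ell-1}}\oplus U^{m-k_1-\cdots-k_{\ell-1}}_{k_\ell}, \] where the first summand has ground set $B_1\cup\cdots\cup B_{\ell-1}$ and the second summand has ground set $B_\ell$.
   Context: Matroid notions: for a matroid $M=(E,\mathcal{I})$, the restriction $M|_A$ is the matroid on $A$ whose independent sets are the independent sets of $M$ contained in $A$; the contraction $M/e$ of a non-loop $e$ is the matroid on $E-\{e\}$ with independent sets $\{I\subseteq E-\{e\}: I\cup\{e\}\in\mathcal{I}\}$ (for a loop it is deletion), and $M/A$ contracts the elements of $A$ one at a time; $\oplus$ is direct sum of matroids on disjoint ground sets. The uniform matroid $U^m_n$ ($0\le m\le n$) is the matroid on an $n$-element set whose independent sets are all subsets of size at most $m$; $U^t_k$ with a specified ground set of size $k$ means the uniform matroid of rank $t$ on that set. For an ordered set partition $\pi=(B_1,\dots,B_k)$ of $E$ (nonempty pairwise disjoint parts with union $E$), the term associated to $\pi$ is \[T(\pi)=M|_{B_1}\oplus (M/B_1)|_{B_2}\oplus\cdots\oplus\Big(M/\bigcup_{i=1}^{k-2}B_i\Big)\Big|_{B_{k-1}}\oplus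 M/\bigcup_{i=1}^{k-1}B_i.\] -}

module Defs where

open import Data.Bool using (Bool; true; false; _∧_; if_then_else_)
open import Data.Nat using (ℕ; _≤ᵇ_; _∸_; _+_)
open import Data.Fin using (Fin)
open import Data.List using (List; []; _∷_; foldl; allFin; take; drop; map; length)
open import Data.Nat.ListAction using (sum)
open import Data.List.Relation.Unary.All using (All)
open import Data.List.Relation.Unary.AllPairs using (AllPairs)
open import Data.Vec using (lookup)
open import Data.Fin.Subset using (Subset; _⊆_; _∪_; _∩_; _─_; ⁅_⁆; ⊥; ⊤; ⋃; ∣_∣; Nonempty; Empty)
open import Data.Fin.Subset.Properties using (_⊆?_)
open import Data.Product using (_×_)
open import Relation.Nullary.Decidable using (⌊_⌋)
open import Relation.Binary.PropositionalEquality using (_≡_)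

-- A matroid (more precisely: a set system) whose ground set is a subset of
-- the fixed universe Fin n.  Independence is Boolean-valued (decidable);
-- by convention `indep I` is false unless I ⊆ ground.
record Matroid (n : ℕ) : Set where
  field
    ground : Subset n
    indep  : Subset n → Bool
open Matroid public

_⊆ᵇ_ : ∀ {n} → Subset n → Subset n → Bool
I ⊆ᵇ A = ⌊ I ⊆? A ⌋

uniformOn : ∀ {n} → Subset n → ℕ → Matroid n
uniformOn A t = record { ground = A ; indep = λ I → (I ⊆ᵇ A) ∧ (∣ I ∣ ≤ᵇ t) }

U : (m n : ℕ) → Matroid n
U m n = uniformOn ⊤ m

emptyMatroid : ∀ {n} → Matroid n
emptyMatroid = uniformOn ⊥ 0

restrict : ∀ {n} → Matroid n → Subset n → Matroid n
restrict M B = record { ground = B ; indep = λ I → (I ⊆ᵇ B) ∧ indep M I }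

-- contraction of a single element e: deletion if e is a loop, otherwise
-- I independent iff I ⊆ E - e and I ∪ {e} independent in M
contract₁ : ∀ {n} → Matroid n → Fin n → Matroid n
contract₁ M e = record
  { ground = ground M ─ ⁅ e ⁆
  ; indep  = λ I → (I ⊆ᵇ (ground M ─ ⁅ e ⁆)) ∧
                   (if indep M ⁅ e ⁆ then indep M (I ∪ ⁅ e ⁆) else indep M I)
  }

contract : ∀ {n} → Matroid n → Subset n → Matroid n
contract {n} M A = foldl (λ M' e → if lookup A e then contract₁ M' e else M') M (allFin n)

_⊕_ : ∀ {n} → Matroid n → Matroid n → Matroid n
M ⊕ N = record
  { ground = ground M ∪ ground N
  ; indep  = λ I → (I ⊆ᵇ (ground M ∪ ground N)) ∧ indep M (I ∩ ground M) ∧ indep N (I ∩ ground N)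
  }
infixr 6 _⊕_

_≅_ : ∀ {n} → Matroid n → Matroid n → Set
M ≅ N = (ground M ≡ ground N) × (∀ I → indep M I ≡ indep N I)
infix 4 _≅_

record IsOrderedSetPartition {n : ℕ} (π : List (Subset n)) : Set where
  field
    nonempty : All Nonempty π
    disjoint : AllPairs (λ A B → Empty (A ∩ B)) π
    covers   : ⋃ π ≡ ⊤

-- term associated to an ordered set partition:
--   M|B₁ ⊕ (M/B₁)|B₂ ⊕ ... ⊕ (M/(B₁∪...∪B_{j-2}))|B_{j-1} ⊕ M/(B₁∪...∪B_{j-1})
-- termAux M D π' : D is the union of the blocks already processed.
termAux : ∀ {n} → Matroid n → Subset n → List (Subset n) → Matroid n
termAux M D []            = emptyMatroid
termAux M D (B ∷ [])      = contract M D
termAux M D (B ∷ B' ∷ πs) = restrict (contract M D) B ⊕ termAux M (D ∪ B) (B' ∷ πs)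

term : ∀ {n} → Matroid n → List (Subset n) → Matroid n
term M π = termAux M ⊥ π

prefixSize : ∀ {n} → List (Subset n) → ℕ → ℕ
prefixSize π i = sum (take i (map ∣_∣ π))

-- Every matroid occurring in the argument is handled through a *description*
-- (G , P): its ground set is G and I is independent iff I ⊆ G and P I.
-- Descriptions are compatible with direct sums, restrictions and single-element
-- contractions, and two matroids with the same description are equal.
--
-- 1. Contracting U^m_n by a set D gives the uniform matroid of rank m − |D| on
--    E − D: contracting one element lowers the rank by one, or does nothing if
--    the element is a loop or was already removed.
-- 2. Hence the term of U^m on a partition (B₁,…,B_j) is described by the
--    "budget" predicate: |I ∩ B_i| ≤ m − (k₁ + ⋯ + k_{i−1}) for every block.
-- 3. Once the blocks B₁,…,B_ℓ exhaust the budget m, the earlier blocks impose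
--    no condition and the later ones become loops; computing both right-hand
--    sides of the theorem gives the same descriptions, which proves it.
module Submission where

open import Defs
open import Data.Bool using (true; false; T; if_then_else_)
open import Data.Bool.Properties using (T-∧; T-≡; ⇔→≡)
open import Data.Nat using (ℕ; zero; suc; _≤_; _<_; _∸_; _+_; z≤n; s≤s; s≤s⁻¹)
open import Data.Nat.Properties
open import Data.List using (List; []; _∷_; take; drop; foldl; allFin)
open import Data.List.Relation.Unary.All using (All; []; _∷_)
import Data.List.Relation.Unary.All as All
open import Data.List.Relation.Unary.AllPairs using (AllPairs; []; _∷_)
open import Data.List.Relation.Unary.Any using (here; there)
import Data.List.Membership.Propositional as List
open import Data.List.Membership.Propositional.Properties using (∈-allFin)
open import Data.Fin using (Fin)
open import Data.Fin.Subset using (Subset; ⋃; _∈_; _∉_; _⊆_; _∪_; _∩_; _─_; ⁅_⁆; ∣_∣; ⊤; ⊥; Empty)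
open import Data.Fin.Subset.Properties
open import Data.Vec using ([]; _∷_; lookup; here; there)
open import Data.Vec.Properties using ([]=⇒lookup; lookup⇒[]=)
open import Data.Unit using (tt) renaming (⊤ to Unit)
open import Data.Empty using (⊥-elim)
open import Data.Sum using (inj₁; inj₂)
open import Data.Product using (_×_; _,_; proj₁; proj₂)
open import Data.Product.Function.NonDependent.Propositional using (_×-⇔_)
open import Function.Bundles using (_⇔_; mk⇔; Equivalence)
open import Function.Construct.Composition using (_⇔-∘_)
open import Function.Construct.Identity using (⇔-id)
open import Function.Construct.Symmetry using (⇔-sym)
open import Relation.Nullary using (¬_; yes; no)
open import Relation.Nullary.Decidable using (toWitness; fromWitness)
open import Relation.Binary.PropositionalEquality

open Equivalence using (to; from)

private
  variable
    n r t : ℕ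
    e x : Fin n
    p q s A B D G H I S : Subset n
    P Q : Subset n → Set
    M N : Matroid n
    π rest : List (Subset n)

drop-conjunct : {X Y : Set} → X → (X × Y) ⇔ Y
drop-conjunct x = mk⇔ proj₂ (x ,_)

under : {X Y Z : Set} → (X → Y ⇔ Z) → (X × Y) ⇔ (X × Z)
under f = mk⇔ (λ (x , y) → x , to (f x) y) (λ (x , z) → x , from (f x) z)

Disjoint : Subset n → Subset n → Set
Disjoint p q = Empty (p ∩ q)

disjoint-∈ : Disjoint p q → x ∈ p → x ∉ q
disjoint-∈ d x∈p x∈q = d (_ , x∈p∩q⁺ (x∈p , x∈q))

⊥-disjoint : Disjoint ⊥ p
⊥-disjoint {p = p} (_ , x∈⊥∩p) = ∉⊥ (proj₁ (x∈p∩q⁻ ⊥ p x∈⊥∩p))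

∪-disjoint : Disjoint p s → Disjoint q s → Disjoint (p ∪ q) s
∪-disjoint {p = p} {s} {q} dp dq (_ , x∈p∪q∩s) with x∈p∩q⁻ (p ∪ q) s x∈p∪q∩s
... | x∈p∪q , x∈s with x∈p∪q⁻ p q x∈p∪q
...   | inj₁ x∈p = disjoint-∈ dp x∈p x∈s
...   | inj₂ x∈q = disjoint-∈ dq x∈q x∈s

x∈p─q⇒x∉q : ∀ (p q : Subset n) → x ∈ p ─ q → x ∉ q
x∈p─q⇒x∉q (_ ∷ p) (false ∷ q) here       ()
x∈p─q⇒x∉q (_ ∷ p) (_ ∷ q)     (there x∈) (there x∈q) = x∈p─q⇒x∉q p q x∈ x∈q

⁅⁆⊆ : x ∈ p → ⁅ x ⁆ ⊆ p
⁅⁆⊆ {x = x} {p = p} x∈p y∈⁅x⁆ = subst (_∈ p) (sym (x∈⁅y⁆⇒x≡y x y∈⁅x⁆)) x∈p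

∪-⊆ : p ⊆ s → q ⊆ s → p ∪ q ⊆ s
∪-⊆ {p = p} {q = q} p⊆s q⊆s x∈p∪q with x∈p∪q⁻ p q x∈p∪q
... | inj₁ x∈p = p⊆s x∈p
... | inj₂ x∈q = q⊆s x∈q

⊆⇒∩≡ : p ⊆ q → p ∩ q ≡ p
⊆⇒∩≡ {p = p} {q = q} p⊆q = ⊆-antisym (p∩q⊆p p q) (λ x∈p → x∈p∩q⁺ (x∈p , p⊆q x∈p))

∩-absorb : q ⊆ s → (I ∩ s) ∩ q ≡ I ∩ q
∩-absorb {q = q} {s = s} {I = I} q⊆s = begin
  (I ∩ s) ∩ q  ≡⟨ ∩-assoc I s q ⟩
  I ∩ (s ∩ q)  ≡⟨ cong (I ∩_) (∩-comm s q) ⟩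
  I ∩ (q ∩ s)  ≡⟨ cong (I ∩_) (⊆⇒∩≡ q⊆s) ⟩
  I ∩ q        ∎
  where open ≡-Reasoning

complement : Disjoint D s → D ∪ s ≡ ⊤ → ⊤ ─ D ≡ s
complement {D = D} {s = s} d cover = ⊆-antisym in-s (λ x∈s → x∈p∧x∉q⇒x∈p─q ∈⊤ (λ x∈D → disjoint-∈ d x∈D x∈s))
  where
  in-s : ⊤ ─ D ⊆ s
  in-s {x} x∈⊤─D with x∈p∪q⁻ D s (subst (x ∈_) (sym cover) ∈⊤)
  ... | inj₁ x∈D = ⊥-elim (x∈p─q⇒x∉q ⊤ D x∈⊤─D x∈D)
  ... | inj₂ x∈s = x∈s

∣p∪q∣+∣p∩q∣ : ∀ (p q : Subset n) → ∣ p ∪ q ∣ + ∣ p ∩ q ∣ ≡ ∣ p ∣ + ∣ q ∣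
∣p∪q∣+∣p∩q∣ []         []         = refl
∣p∪q∣+∣p∩q∣ (true ∷ p)  (true ∷ q)  =
  cong suc (trans (+-suc ∣ p ∪ q ∣ ∣ p ∩ q ∣) (trans (cong suc (∣p∪q∣+∣p∩q∣ p q)) (sym (+-suc ∣ p ∣ ∣ q ∣))))
∣p∪q∣+∣p∩q∣ (true ∷ p)  (false ∷ q) = cong suc (∣p∪q∣+∣p∩q∣ p q)
∣p∪q∣+∣p∩q∣ (false ∷ p) (true ∷ q)  = trans (cong suc (∣p∪q∣+∣p∩q∣ p q)) (sym (+-suc ∣ p ∣ ∣ q ∣))
∣p∪q∣+∣p∩q∣ (false ∷ p) (false ∷ q) = ∣p∪q∣+∣p∩q∣ p q

∣p∪q∣≤∣p∣+∣q∣ : ∀ (p q : Subset n) → ∣ p ∪ q ∣ ≤ ∣ p ∣ + ∣ q ∣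
∣p∪q∣≤∣p∣+∣q∣ p q = subst (∣ p ∪ q ∣ ≤_) (∣p∪q∣+∣p∩q∣ p q) (m≤m+n ∣ p ∪ q ∣ ∣ p ∩ q ∣)

disjoint-∣∪∣ : ∀ {n} {p q : Subset n} → Disjoint p q → ∣ p ∪ q ∣ ≡ ∣ p ∣ + ∣ q ∣
disjoint-∣∪∣ {n} {p} {q} d = begin
  ∣ p ∪ q ∣                ≡⟨ sym (+-identityʳ ∣ p ∪ q ∣) ⟩
  ∣ p ∪ q ∣ + 0            ≡⟨ cong (∣ p ∪ q ∣ +_) (sym (trans (cong ∣_∣ (Empty-unique d)) (∣⊥∣≡0 n))) ⟩
  ∣ p ∪ q ∣ + ∣ p ∩ q ∣    ≡⟨ ∣p∪q∣+∣p∩q∣ p q ⟩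
  ∣ p ∣ + ∣ q ∣            ∎
  where open ≡-Reasoning

∣p∪⁅x⁆∣ : x ∉ p → ∣ p ∪ ⁅ x ⁆ ∣ ≡ suc ∣ p ∣
∣p∪⁅x⁆∣ {x = x} {p = p} x∉p = begin
  ∣ p ∪ ⁅ x ⁆ ∣  ≡⟨ disjoint-∣∪∣ (λ (_ , y∈) → x∉p (⁅⁆-element (x∈p∩q⁻ p ⁅ x ⁆ y∈))) ⟩
  ∣ p ∣ + ∣ ⁅ x ⁆ ∣  ≡⟨ cong (∣ p ∣ +_) (∣⁅x⁆∣≡1 x) ⟩
  ∣ p ∣ + 1      ≡⟨ +-comm ∣ p ∣ 1 ⟩
  suc ∣ p ∣      ∎
  where
  open ≡-Reasoning
  ⁅⁆-element : ∀ {y} → y ∈ p × y ∈ ⁅ x ⁆ → x ∈ p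
  ⁅⁆-element (y∈p , y∈⁅x⁆) = subst (_∈ p) (x∈⁅y⁆⇒x≡y x y∈⁅x⁆) y∈p

∣∪∣≤0 : ∀ (p q : Subset n) → ∣ p ∪ q ∣ ≤ 0 ⇔ (∣ p ∣ ≤ 0 × ∣ q ∣ ≤ 0)
∣∪∣≤0 p q = mk⇔
  (λ h → ≤-trans (∣p∣≤∣p∪q∣ p q) h , ≤-trans (∣q∣≤∣p∪q∣ p q) h)
  (λ (hp , hq) → ≤-trans (∣p∪q∣≤∣p∣+∣q∣ p q) (+-mono-≤ hp hq))

AtMost : ℕ → Subset n → Set
AtMost t I = ∣ I ∣ ≤ t

record Describes (M : Matroid n) (G : Subset n) (P : Subset n → Set) : Set where
  constructor describes
  field
    ground≡ : ground M ≡ G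
    indep⇔  : ∀ I → T (indep M I) ⇔ (I ⊆ G × P I)
open Describes

⊆ᵇ⇔ : T (p ⊆ᵇ q) ⇔ p ⊆ q
⊆ᵇ⇔ = mk⇔ (λ h {y} → toWitness h {y}) (λ h → fromWitness (λ {y} → h {y}))

uniform-describes : ∀ (A : Subset n) t → Describes (uniformOn A t) A (AtMost t)
uniform-describes A t = describes refl λ I → (⊆ᵇ⇔ ×-⇔ mk⇔ (≤ᵇ⇒≤ ∣ I ∣ t) ≤⇒≤ᵇ) ⇔-∘ T-∧

describes-weaken : Describes M G P → (∀ I → I ⊆ G → P I ⇔ Q I) → Describes M G Q
describes-weaken (describes g d) P⇔Q = describes g λ I → under (P⇔Q I) ⇔-∘ d I

describes-ground : G ≡ H → Describes M G P → Describes M H P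
describes-ground refl d = d

describes-≅ : Describes M G P → Describes N G P → M ≅ N
describes-≅ (describes gM dM) (describes gN dN) =
  trans gM (sym gN) , λ I → ⇔→≡ (T-≡ ⇔-∘ (⇔-sym (dN I) ⇔-∘ (dM I ⇔-∘ ⇔-sym T-≡)))

⊕-describes : Describes M G P → Describes N H Q →
  Describes (M ⊕ N) (G ∪ H) (λ I → P (I ∩ G) × Q (I ∩ H))
⊕-describes {P = P} {Q = Q} (describes refl dM) (describes refl dN) = describes refl λ I →
  (⊆ᵇ⇔ ×-⇔ (summand {R = P} dM I ×-⇔ summand {R = Q} dN I)) ⇔-∘ ((⇔-id _ ×-⇔ T-∧) ⇔-∘ T-∧)
  where
  -- the summand's own ground-set condition holds automatically for I ∩ ground
  summand : ∀ {L : Matroid _} {R} → (∀ J → T (indep L J) ⇔ (J ⊆ ground L × R J)) →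
            ∀ I → T (indep L (I ∩ ground L)) ⇔ R (I ∩ ground L)
  summand {L = L} d I = drop-conjunct (λ {y} → p∩q⊆q I (ground L) {y}) ⇔-∘ d (I ∩ ground L)

restrict-describes : Describes M G P → B ⊆ G → Describes (restrict M B) B P
restrict-describes {B = B} (describes refl d) B⊆G = describes refl λ I →
  under (λ (I⊆B : I ⊆ B) → drop-conjunct (λ {y} → ⊆-trans I⊆B B⊆G {y})) ⇔-∘ ((⊆ᵇ⇔ ×-⇔ d I) ⇔-∘ T-∧)

T-if : ∀ {b u v} → T b → T (if b then u else v) ⇔ T u
T-if {b = true} _ = ⇔-id _

T-if-¬ : ∀ {b u v} → ¬ T b → T (if b then u else v) ⇔ T v
T-if-¬ {b = true}  ¬b = ⊥-elim (¬b tt)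
T-if-¬ {b = false} _  = ⇔-id _

contract₁-nonloop : Describes M G P → T (indep M ⁅ e ⁆) →
  Describes (contract₁ M e) (G ─ ⁅ e ⁆) (λ I → P (I ∪ ⁅ e ⁆))
contract₁-nonloop {M = M} {e = e} (describes refl d) nonloop = describes refl λ I →
  under (λ (I⊆ : I ⊆ _) → drop-conjunct (λ {y} → I∪e⊆G I⊆ {y})) ⇔-∘ ((⊆ᵇ⇔ ×-⇔ (d (I ∪ ⁅ e ⁆) ⇔-∘ T-if nonloop)) ⇔-∘ T-∧)
  where
  e∈G : e ∈ ground M
  e∈G = proj₁ (to (d ⁅ e ⁆) nonloop) (x∈⁅x⁆ e)
  I∪e⊆G : ∀ {I} → I ⊆ ground M ─ ⁅ e ⁆ → I ∪ ⁅ e ⁆ ⊆ ground M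
  I∪e⊆G I⊆ = ∪-⊆ (⊆-trans I⊆ (p─q⊆p (ground M) ⁅ e ⁆)) (⁅⁆⊆ e∈G)

contract₁-loop : Describes M G P → ¬ T (indep M ⁅ e ⁆) → Describes (contract₁ M e) (G ─ ⁅ e ⁆) P
contract₁-loop {M = M} {e = e} (describes refl d) loop = describes refl λ I →
  under (λ (I⊆ : I ⊆ ground M ─ ⁅ e ⁆) → drop-conjunct (λ {y} → ⊆-trans I⊆ (p─q⊆p (ground M) ⁅ e ⁆) {y}))
  ⇔-∘ ((⊆ᵇ⇔ ×-⇔ (d I ⇔-∘ T-if-¬ loop)) ⇔-∘ T-∧)

contract₁-uniform-∈ : Describes M A (AtMost r) → e ∈ A → Describes (contract₁ M e) (A ─ ⁅ e ⁆) (AtMost (r ∸ 1))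
contract₁-uniform-∈ {r = zero} {e = e} d e∈A =
  contract₁-loop d λ h → 1+n≰n (subst (_≤ 0) (∣⁅x⁆∣≡1 e) (proj₂ (to (indep⇔ d ⁅ e ⁆) h)))
contract₁-uniform-∈ {M = M} {A = A} {r = suc r} {e = e} d e∈A =
  describes-weaken (contract₁-nonloop d e-independent) λ I I⊆ →
    subst (λ c → c ≤ suc r ⇔ ∣ I ∣ ≤ r) (sym (∣p∪⁅x⁆∣ (λ e∈I → x∈p─q⇒x∉q A ⁅ e ⁆ (I⊆ e∈I) (x∈⁅x⁆ e))))
      (mk⇔ s≤s⁻¹ s≤s)
  where
  e-independent : T (indep M ⁅ e ⁆)
  e-independent = from (indep⇔ d ⁅ e ⁆) (⁅⁆⊆ e∈A , ≤-trans (≤-reflexive (∣⁅x⁆∣≡1 e)) (s≤s z≤n))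

contract₁-uniform-∉ : Describes M A (AtMost r) → e ∉ A → Describes (contract₁ M e) A (AtMost r)
contract₁-uniform-∉ {A = A} {e = e} d e∉A = describes-ground A─e≡A
  (contract₁-loop d λ h → e∉A (proj₁ (to (indep⇔ d ⁅ e ⁆) h) (x∈⁅x⁆ e)))
  where
  A─e≡A : A ─ ⁅ e ⁆ ≡ A
  A─e≡A = ⊆-antisym (p─q⊆p A ⁅ e ⁆)
    (λ x∈A → x∈p∧x∉q⇒x∈p─q x∈A λ x∈⁅e⁆ → e∉A (subst (_∈ A) (x∈⁅y⁆⇒x≡y _ x∈⁅e⁆) x∈A))

addIfIn : Subset n → Subset n → Fin n → Subset n
addIfIn D S e = if lookup D e then S ∪ ⁅ e ⁆ else S

scanned : Subset n → Subset n → List (Fin n) → Subset n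
scanned D = foldl (addIfIn D)

scanned-⊇ : ∀ xs → S ⊆ scanned D S xs
scanned-⊇ [] = ⊆-refl
scanned-⊇ {S = S} {D = D} (e ∷ xs) = ⊆-trans step (scanned-⊇ {D = D} xs)
  where
  step : S ⊆ addIfIn D S e
  step with lookup D e
  ... | true  = p⊆p∪q ⁅ e ⁆
  ... | false = λ x∈S → x∈S

scanned-hit : ∀ xs → x ∈ D → x List.∈ xs → x ∈ scanned D S xs
scanned-hit {x = x} {D = D} {S = S} (x ∷ xs) x∈D (here refl) rewrite []=⇒lookup x∈D =
  scanned-⊇ {D = D} xs (q⊆p∪q S ⁅ x ⁆ (x∈⁅x⁆ x))
scanned-hit (_ ∷ xs) x∈D (there x∈xs) = scanned-hit xs x∈D x∈xs

scanned-⊆ : ∀ xs → S ⊆ D → scanned D S xs ⊆ D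
scanned-⊆ []       S⊆D = S⊆D
scanned-⊆ {S = S} {D = D} (e ∷ xs) S⊆D = scanned-⊆ xs step
  where
  step : addIfIn D S e ⊆ D
  step with lookup D e in eq
  ... | true  = ∪-⊆ S⊆D (⁅⁆⊆ (lookup⇒[]= e D eq))
  ... | false = S⊆D

scanned-all : ∀ (D : Subset n) → scanned D ⊥ (allFin n) ≡ D
scanned-all D = ⊆-antisym (scanned-⊆ (allFin _) ⊥⊆) (λ x∈D → scanned-hit (allFin _) x∈D (∈-allFin _))

-- Invariant of the fold: after contracting S, the matroid is U^{m−|S|} on E − S.
module _ (m : ℕ) (D : Subset n) where

  contract-step : Describes M (⊤ ─ S) (AtMost (m ∸ ∣ S ∣)) →
    Describes (if lookup D e then contract₁ M e else M) (⊤ ─ addIfIn D S e) (AtMost (m ∸ ∣ addIfIn D S e ∣))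
  contract-step {S = S} {e = e} d with lookup D e
  ... | false = d
  ... | true with e ∈? S
  ...   | yes e∈S = subst (λ S' → Describes _ (⊤ ─ S') (AtMost (m ∸ ∣ S' ∣))) (sym S∪e≡S)
                      (contract₁-uniform-∉ d (λ e∈⊤─S → x∈p─q⇒x∉q ⊤ S e∈⊤─S e∈S))
    where
    S∪e≡S : S ∪ ⁅ e ⁆ ≡ S
    S∪e≡S = ⊆-antisym (∪-⊆ ⊆-refl (⁅⁆⊆ e∈S)) (p⊆p∪q ⁅ e ⁆)
  ...   | no e∉S = subst₂ (Describes _) (p─q─r≡p─q∪r ⊤ S ⁅ e ⁆) (cong AtMost rank)
                      (contract₁-uniform-∈ d (x∈p∧x∉q⇒x∈p─q ∈⊤ e∉S))
    where
    rank : m ∸ ∣ S ∣ ∸ 1 ≡ m ∸ ∣ S ∪ ⁅ e ⁆ ∣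
    rank = trans (∸-+-assoc m ∣ S ∣ 1) (cong (m ∸_) (trans (+-comm ∣ S ∣ 1) (sym (∣p∪⁅x⁆∣ e∉S))))

  contract-scan : ∀ xs → Describes M (⊤ ─ S) (AtMost (m ∸ ∣ S ∣)) →
    Describes (foldl (λ M' e → if lookup D e then contract₁ M' e else M') M xs)
              (⊤ ─ scanned D S xs) (AtMost (m ∸ ∣ scanned D S xs ∣))
  contract-scan []       d = d
  contract-scan (e ∷ xs) d = contract-scan xs (contract-step d)

contract-uniform : ∀ m (D : Subset n) → Describes (contract (U m n) D) (⊤ ─ D) (AtMost (m ∸ ∣ D ∣))
contract-uniform {n} m D =
  subst (λ S → Describes (contract (U m n) D) (⊤ ─ S) (AtMost (m ∸ ∣ S ∣))) (scanned-all D)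
    (contract-scan m D (allFin n) initial)
  where
  initial : Describes (U m n) (⊤ ─ ⊥) (AtMost (m ∸ ∣ ⊥ {n = n} ∣))
  initial = subst₂ (Describes (U m n)) (sym (p─⊥≡p ⊤)) (cong (λ c → AtMost (m ∸ c)) (sym (∣⊥∣≡0 n)))
              (uniform-describes ⊤ m)

Budget : ℕ → List (Subset n) → Subset n → Set
Budget t []      I = Unit
Budget t (B ∷ π) I = AtMost t (I ∩ B) × Budget (t ∸ ∣ B ∣) π I

budget-∩ : ∀ π → All (_⊆ G) π → Budget t π (I ∩ G) ⇔ Budget t π I
budget-∩ []      []           = ⇔-id _
budget-∩ {I = I} (B ∷ π) (B⊆G ∷ π⊆G) rewrite ∩-absorb {I = I} B⊆G = ⇔-id _ ×-⇔ budget-∩ π π⊆G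

budget-split : ∀ k π → Budget t π I ⇔ (Budget t (take k π) I × Budget (t ∸ prefixSize π k) (drop k π) I)
budget-split zero    π       = mk⇔ (tt ,_) proj₂
budget-split (suc k) []      = mk⇔ (λ _ → tt , tt) proj₁
budget-split {t = t} {I = I} (suc k) (B ∷ π) = mk⇔
  (λ (b , rest) → let (pre , post) = to IH rest in (b , pre) , subst (λ c → Budget c (drop k π) I) assoc post)
  (λ ((b , pre) , post) → b , from IH (pre , subst (λ c → Budget c (drop k π) I) (sym assoc) post))
  where
  IH = budget-split k π
  assoc : t ∸ ∣ B ∣ ∸ prefixSize π k ≡ t ∸ (∣ B ∣ + prefixSize π k)
  assoc = ∸-+-assoc t ∣ B ∣ (prefixSize π k)

budget-slack : ∀ k π → prefixSize π k ≤ t → Budget t (take k π) I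
budget-slack zero    π       _ = tt
budget-slack (suc k) []      _ = tt
budget-slack {t = t} {I = I} (suc k) (B ∷ π) fits =
  ≤-trans (∣p∩q∣≤∣q∣ I B) (≤-trans (m≤m+n ∣ B ∣ (prefixSize π k)) fits) ,
  budget-slack k π (m+n≤o⇒m≤o∸n (prefixSize π k) (subst (_≤ t) (+-comm ∣ B ∣ (prefixSize π k)) fits))

budget-zero : ∀ π → Budget 0 π I ⇔ AtMost 0 (I ∩ ⋃ π)
budget-zero {n} {I = I} [] =
  mk⇔ (λ _ → subst (_≤ 0) (sym (trans (cong ∣_∣ (∩-zeroʳ I)) (∣⊥∣≡0 n))) ≤-refl) (λ _ → tt)
budget-zero {I = I} (B ∷ π) rewrite 0∸n≡0 ∣ B ∣ | ∩-distribˡ-∪ I B (⋃ π) =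
  ⇔-sym (∣∪∣≤0 (I ∩ B) (I ∩ ⋃ π)) ⇔-∘ (⇔-id _ ×-⇔ budget-zero π)

budget-after-prefix : ∀ k π → prefixSize π k ≤ t → Budget t π I ⇔ Budget (t ∸ prefixSize π k) (drop k π) I
budget-after-prefix k π fits = drop-conjunct (budget-slack k π fits) ⇔-∘ budget-split k π

budget-exhausted : ∀ k π → prefixSize π k ≡ t → Budget t π I ⇔ AtMost 0 (I ∩ ⋃ (drop k π))
budget-exhausted {t = t} {I = I} k π exact =
  budget-zero (drop k π) ⇔-∘ subst (λ c → Budget t π I ⇔ Budget c (drop k π) I) used-up (budget-after-prefix k π (≤-reflexive exact))
  where
  used-up : t ∸ prefixSize π k ≡ 0
  used-up = trans (cong (t ∸_) exact) (n∸n≡0 t)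

budget-overshoot : ∀ k π → drop k π ≡ B ∷ rest → prefixSize π k ≤ t → t ≤ prefixSize π k + ∣ B ∣ →
  Budget t π I ⇔ (AtMost (t ∸ prefixSize π k) (I ∩ B) × AtMost 0 (I ∩ ⋃ rest))
budget-overshoot {B = B} {rest = rest} {t = t} {I = I} k π split fits overshoot =
  (⇔-id _ ×-⇔ tail) ⇔-∘ subst (λ ys → Budget t π I ⇔ Budget (t ∸ prefixSize π k) ys I) split (budget-after-prefix k π fits)
  where
  used-up : t ∸ prefixSize π k ∸ ∣ B ∣ ≡ 0
  used-up = trans (∸-+-assoc t (prefixSize π k) ∣ B ∣) (m≤n⇒m∸n≡0 overshoot)
  tail : Budget (t ∸ prefixSize π k ∸ ∣ B ∣) rest I ⇔ AtMost 0 (I ∩ ⋃ rest)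
  tail rewrite used-up = budget-zero rest

blocks⊆⋃ : ∀ (π : List (Subset n)) → All (_⊆ ⋃ π) π
blocks⊆⋃ []      = []
blocks⊆⋃ (B ∷ π) = p⊆p∪q (⋃ π) ∷ All.map (λ B′⊆ {y} y∈B′ → q⊆p∪q B (⋃ π) (B′⊆ y∈B′)) (blocks⊆⋃ π)

termAux-describes : ∀ m B πs (D : Subset n) →
  AllPairs Disjoint (B ∷ πs) → All (Disjoint D) (B ∷ πs) → D ∪ ⋃ (B ∷ πs) ≡ ⊤ →
  Describes (termAux (U m n) D (B ∷ πs)) (⋃ (B ∷ πs)) (Budget (m ∸ ∣ D ∣) (B ∷ πs))
termAux-describes m B [] D _ (D∩B ∷ []) cover =
  describes-ground (sym (∪-identityʳ B))
    (describes-weaken (describes-ground (complement D∩B cover′) (contract-uniform m D))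
      λ I I⊆B → subst (λ J → AtMost (m ∸ ∣ D ∣) I ⇔ (AtMost (m ∸ ∣ D ∣) J × Unit)) (sym (⊆⇒∩≡ I⊆B)) (mk⇔ (_, tt) proj₁))
  where
  cover′ : D ∪ B ≡ ⊤
  cover′ = trans (cong (D ∪_) (sym (∪-identityʳ B))) cover
termAux-describes {n} m B (B′ ∷ πs) D (B∩later ∷ later-disjoint) (D∩B ∷ D∩later) cover =
  describes-weaken (⊕-describes first-block later-blocks) λ I _ → ⇔-id _ ×-⇔ later⇔ I
  where
  later = B′ ∷ πs
  first-block : Describes (restrict (contract (U m n) D) B) B (AtMost (m ∸ ∣ D ∣))
  first-block = restrict-describes (contract-uniform m D)
    (λ x∈B → x∈p∧x∉q⇒x∈p─q ∈⊤ (λ x∈D → disjoint-∈ D∩B x∈D x∈B))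
  later-blocks : Describes (termAux (U m n) (D ∪ B) later) (⋃ later) (Budget (m ∸ ∣ D ∪ B ∣) later)
  later-blocks = termAux-describes m B′ πs (D ∪ B) later-disjoint
    (All.zipWith (λ (d , b) → ∪-disjoint d b) (D∩later , B∩later))
    (trans (∪-assoc D B (⋃ later)) cover)
  remaining : m ∸ ∣ D ∪ B ∣ ≡ m ∸ ∣ D ∣ ∸ ∣ B ∣
  remaining = trans (cong (m ∸_) (disjoint-∣∪∣ D∩B)) (sym (∸-+-assoc m ∣ D ∣ ∣ B ∣))
  later⇔ : ∀ I → Budget (m ∸ ∣ D ∪ B ∣) later (I ∩ ⋃ later) ⇔ Budget (m ∸ ∣ D ∣ ∸ ∣ B ∣) later I
  later⇔ I rewrite remaining = budget-∩ later (blocks⊆⋃ later)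

term-describes : ∀ m (π : List (Subset n)) → IsOrderedSetPartition π → Describes (term (U m n) π) ⊤ (Budget m π)
term-describes {n} m [] P =
  describes-ground (IsOrderedSetPartition.covers P)
    (describes-weaken (uniform-describes ⊥ 0)
      λ I I⊆⊥ → mk⇔ (λ _ → tt) (λ _ → subst (∣ I ∣ ≤_) (∣⊥∣≡0 n) (p⊆q⇒∣p∣≤∣q∣ I⊆⊥)))
term-describes {n} m (B ∷ πs) P =
  subst₂ (Describes _) (IsOrderedSetPartition.covers P) (cong (λ c → Budget (m ∸ c) (B ∷ πs)) (∣⊥∣≡0 n))
    (termAux-describes m B πs ⊥ (IsOrderedSetPartition.disjoint P) (All.tabulate (λ _ → ⊥-disjoint))
      (trans (∪-identityˡ _) (IsOrderedSetPartition.covers P)))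

⋃-take-drop : ∀ k (π : List (Subset n)) → ⋃ (take k π) ∪ ⋃ (drop k π) ≡ ⋃ π
⋃-take-drop zero    π       = ∪-identityˡ (⋃ π)
⋃-take-drop (suc k) []      = ∪-identityˡ ⊥
⋃-take-drop (suc k) (B ∷ π) = trans (∪-assoc B (⋃ (take k π)) (⋃ (drop k π))) (cong (B ∪_) (⋃-take-drop k π))

∣⋃take∣≤prefixSize : ∀ k (π : List (Subset n)) → ∣ ⋃ (take k π) ∣ ≤ prefixSize π k
∣⋃take∣≤prefixSize {n} zero π    = ≤-reflexive (∣⊥∣≡0 n)
∣⋃take∣≤prefixSize {n} (suc k) [] = ≤-reflexive (∣⊥∣≡0 n)
∣⋃take∣≤prefixSize (suc k) (B ∷ π) =
  ≤-trans (∣p∪q∣≤∣p∣+∣q∣ B (⋃ (take k π))) (+-monoʳ-≤ ∣ B ∣ (∣⋃take∣≤prefixSize k π))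

free-prefix : ∀ k π (I : Subset n) → prefixSize π k ≤ t → AtMost t (I ∩ ⋃ (take k π))
free-prefix k π I fits = ≤-trans (∣p∩q∣≤∣q∣ I _) (≤-trans (∣⋃take∣≤prefixSize k π) fits)

module _ {X : Set} {y : X} {ys : List X} where

  drop-suc-∷ : ∀ k (xs : List X) → drop k xs ≡ y ∷ ys → drop (suc k) xs ≡ ys
  drop-suc-∷ zero    xs       refl = refl
  drop-suc-∷ (suc k) (x ∷ xs) eq   = drop-suc-∷ k xs eq

  drop-take-suc-∷ : ∀ k (xs : List X) → drop k xs ≡ y ∷ ys → drop k (take (suc k) xs) ≡ y ∷ []
  drop-take-suc-∷ zero    xs       refl = refl
  drop-take-suc-∷ (suc k) (x ∷ xs) eq   = drop-take-suc-∷ k xs eq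

prefixSize-suc : ∀ k (π : List (Subset n)) → drop k π ≡ B ∷ rest → prefixSize π (suc k) ≡ prefixSize π k + ∣ B ∣
prefixSize-suc {B = B} zero    π       refl = +-identityʳ ∣ B ∣
prefixSize-suc {B = B} (suc k) (C ∷ π) eq   =
  trans (cong (∣ C ∣ +_) (prefixSize-suc k π eq)) (sym (+-assoc (∣ C ∣) (prefixSize π k) (∣ B ∣)))

prefixSize-past-end : ∀ k (π : List (Subset n)) → drop k π ≡ [] → prefixSize π (suc k) ≡ prefixSize π k
prefixSize-past-end zero    []      refl = refl
prefixSize-past-end (suc k) []      _    = refl
prefixSize-past-end (suc k) (C ∷ π) eq   = cong (∣ C ∣ +_) (prefixSize-past-end k π eq)

term-exact : ∀ m (π : List (Subset n)) → IsOrderedSetPartition π → ∀ ℓ → prefixSize π ℓ ≡ m →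
  term (U m n) π ≅ uniformOn (⋃ (take ℓ π)) m ⊕ uniformOn (⋃ (drop ℓ π)) 0
term-exact {n} m π P ℓ exact = describes-≅ lhs rhs
  where
  X = ⋃ (take ℓ π)
  Y = ⋃ (drop ℓ π)
  lhs : Describes (term (U m n) π) (X ∪ Y) (λ I → AtMost 0 (I ∩ Y))
  lhs = describes-ground (sym (trans (⋃-take-drop ℓ π) (IsOrderedSetPartition.covers P)))
          (describes-weaken (term-describes m π P) λ I _ → budget-exhausted ℓ π exact)
  rhs : Describes (uniformOn X m ⊕ uniformOn Y 0) (X ∪ Y) (λ I → AtMost 0 (I ∩ Y))
  rhs = describes-weaken (⊕-describes (uniform-describes X m) (uniform-describes Y 0))
          λ I _ → drop-conjunct (free-prefix ℓ π I (≤-reflexive exact))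

term-overshoot : ∀ m (π : List (Subset n)) → IsOrderedSetPartition π → ∀ k B rest → drop k π ≡ B ∷ rest →
  prefixSize π k ≤ m → m ≤ prefixSize π k + ∣ B ∣ →
  term (U m n) π ≅ uniformOn (⋃ (take k π)) (prefixSize π k) ⊕ uniformOn B (m ∸ prefixSize π k) ⊕ uniformOn (⋃ rest) 0
term-overshoot {n} m π P k B rest split fits overshoot = describes-≅ lhs rhs
  where
  X = ⋃ (take k π)
  Y = ⋃ rest
  rank = m ∸ prefixSize π k
  Pred : Subset n → Set
  Pred I = AtMost rank (I ∩ B) × AtMost 0 (I ∩ Y)
  covers : X ∪ (B ∪ Y) ≡ ⊤
  covers = trans (cong (λ ys → X ∪ ⋃ ys) (sym split)) (trans (⋃-take-drop k π) (IsOrderedSetPartition.covers P))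
  lhs : Describes (term (U m n) π) (X ∪ (B ∪ Y)) Pred
  lhs = describes-ground (sym covers)
          (describes-weaken (term-describes m π P) λ I _ → budget-overshoot k π split fits overshoot)
  rhs-pred : ∀ I → (AtMost (prefixSize π k) (I ∩ X) × AtMost rank ((I ∩ (B ∪ Y)) ∩ B) × AtMost 0 ((I ∩ (B ∪ Y)) ∩ Y)) ⇔ Pred I
  rhs-pred I rewrite ∩-absorb {I = I} (p⊆p∪q {p = B} Y) | ∩-absorb {I = I} (q⊆p∪q B Y) =
    drop-conjunct (free-prefix k π I ≤-refl)
  rhs : Describes (uniformOn X (prefixSize π k) ⊕ uniformOn B rank ⊕ uniformOn Y 0) (X ∪ (B ∪ Y)) Pred
  rhs = describes-weaken
          (⊕-describes (uniform-describes X (prefixSize π k)) (⊕-describes (uniform-describes B rank) (uniform-describes Y 0)))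
          λ I _ → rhs-pred I

theorem3p3 : (m n : ℕ) → m ≤ n → (π : List (Subset n)) → IsOrderedSetPartition π →
    (ℓ : ℕ) → m ≤ prefixSize π ℓ → (∀ ℓ' → ℓ' < ℓ → prefixSize π ℓ' < m) →
    (prefixSize π ℓ ≡ m →
      term (U m n) π ≅ uniformOn (⋃ (take ℓ π)) m ⊕ uniformOn (⋃ (drop ℓ π)) 0)
    × (m < prefixSize π ℓ →
      term (U m n) π ≅
        uniformOn (⋃ (take (ℓ ∸ 1) π)) (prefixSize π (ℓ ∸ 1))
        ⊕ uniformOn (⋃ (drop (ℓ ∸ 1) (take ℓ π))) (m ∸ prefixSize π (ℓ ∸ 1))
        ⊕ uniformOn (⋃ (drop ℓ π)) 0)
theorem3p3 m n _ π P ℓ _ below = term-exact m π P ℓ , overshoot ℓ below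
  where
  -- ℓ = k + 1 where block k + 1 exists (else the prefix sums would stop growing)
  -- and is the block in which the budget m runs out
  overshoot : ∀ ℓ → (∀ ℓ' → ℓ' < ℓ → prefixSize π ℓ' < m) → m < prefixSize π ℓ →
    term (U m n) π ≅
      uniformOn (⋃ (take (ℓ ∸ 1) π)) (prefixSize π (ℓ ∸ 1))
      ⊕ uniformOn (⋃ (drop (ℓ ∸ 1) (take ℓ π))) (m ∸ prefixSize π (ℓ ∸ 1))
      ⊕ uniformOn (⋃ (drop ℓ π)) 0
  overshoot zero    _     ()
  overshoot (suc k) below m<ps with drop k π in split
  ... | [] = ⊥-elim (<-asym (below k ≤-refl) (subst (m <_) (prefixSize-past-end k π split) m<ps))
  ... | B ∷ rest rewrite drop-suc-∷ k π split | drop-take-suc-∷ k π split | ∪-identityʳ B =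
    term-overshoot m π P k B rest split (<⇒≤ (below k ≤-refl))
      (≤-trans (<⇒≤ m<ps) (≤-reflexive (prefixSize-suc k π split)))
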